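{- Let $t\ge 4$. For every $\alpha\in A_t$ with $\alpha\neq\mathrm{id}$, there exist $\gamma_1,\gamma_2\in A_t$ such that $[[\alpha,\gamma_1],\gamma_2]$ is a double-transposition. Moreover, each $\gamma_i$ can be taken to be either a double-transposition or a 3-cycle.
   Context: $A_t$ is the alternating group on $\{1,\ldots,t\}$ with identity $\mathrm{id}$. The commutator is $[\alpha,\gamma]=\alpha\gamma\alpha^{ -1}\gamma^{ -1}$. A double-transposition is a product of two disjoint transpositions $(a\ b)(c\ d)$. -}

module Defs where

open import Data.Nat using (ℕ)
open import Data.Fin using (Fin)
open import Data.Fin.Permutation using (Permutation′; _⟨$⟩ʳ_; _∘ₚ_; flip; transpose; id; _≈_)
open import Data.List using (List; []; _∷_; length)
open import Data.Product using (Σ; _×_; _,_)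
open import Relation.Binary.PropositionalEquality using (_≡_; _≢_)

-- Permutations of {0,…,t-1} (Fin t) are 'Permutation′ t'.
-- Composition as functions (right-to-left): (σ ⊙ τ) x = σ (τ x).
-- (stdlib's _∘ₚ_ is diagrammatic: π₁ ∘ₚ π₂ applies π₁ first.)
_⊙_ : ∀ {t} → Permutation′ t → Permutation′ t → Permutation′ t
σ ⊙ τ = τ ∘ₚ σ

comm : ∀ {t} → Permutation′ t → Permutation′ t → Permutation′ t
comm α γ = α ⊙ (γ ⊙ (flip α ⊙ flip γ))

prodTransp : ∀ {t} → List (Fin t × Fin t) → Permutation′ t
prodTransp []            = id
prodTransp ((i , j) ∷ l) = transpose i j ⊙ prodTransp l

data Even : ℕ → Set where
  even-zero : Even 0
  even-ss   : ∀ {n} → Even n → Even (ℕ.suc (ℕ.suc n))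

data AllTransp {t : ℕ} : List (Fin t × Fin t) → Set where
  []  : AllTransp []
  _∷_ : ∀ {i j l} → i ≢ j → AllTransp l → AllTransp ((i , j) ∷ l)

IsEvenPerm : ∀ {t} → Permutation′ t → Set
IsEvenPerm {t} σ =
  Σ (List (Fin t × Fin t)) λ l → AllTransp l × Even (length l) × (σ ≈ prodTransp l)

IsId : ∀ {t} → Permutation′ t → Set
IsId σ = ∀ x → σ ⟨$⟩ʳ x ≡ x

IsDoubleTransposition : ∀ {t} → Permutation′ t → Set
IsDoubleTransposition {t} σ =
  Σ (Fin t) λ a → Σ (Fin t) λ b → Σ (Fin t) λ c → Σ (Fin t) λ d →
    (a ≢ b) × (a ≢ c) × (a ≢ d) × (b ≢ c) × (b ≢ d) × (c ≢ d) ×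
    (σ ⟨$⟩ʳ a ≡ b) × (σ ⟨$⟩ʳ b ≡ a) × (σ ⟨$⟩ʳ c ≡ d) × (σ ⟨$⟩ʳ d ≡ c) ×
    (∀ x → x ≢ a → x ≢ b → x ≢ c → x ≢ d → σ ⟨$⟩ʳ x ≡ x)

IsThreeCycle : ∀ {t} → Permutation′ t → Set
IsThreeCycle {t} σ =
  Σ (Fin t) λ a → Σ (Fin t) λ b → Σ (Fin t) λ c →
    (a ≢ b) × (a ≢ c) × (b ≢ c) ×
    (σ ⟨$⟩ʳ a ≡ b) × (σ ⟨$⟩ʳ b ≡ c) × (σ ⟨$⟩ʳ c ≡ a) ×
    (∀ x → x ≢ a → x ≢ b → x ≢ c → σ ⟨$⟩ʳ x ≡ x)

module Submission where

-- Some x is moved by α.  The orbit of x, and if it is short the orbit of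
-- one further point, gives one of five local configurations on k ≤ 6 points.
-- For each we take γ₁, γ₂ to be products of two transpositions on those points.
-- Since α γ₁ α⁻¹ is γ₁ with its points relabelled by α, the double commutator
-- [[α,γ₁],γ₂] only depends on how α moves the points of γ₁; it is therefore the
-- image of a fixed permutation of Fin k, whose shape is checked by computation.

open import Defs
open import Data.Nat using (ℕ; suc; _≤_; _<_)
open import Data.Nat.Properties using (n≤1+n; ≤-trans)
open import Data.Fin using (Fin)
open import Data.Fin.Patterns using (0F; 1F; 2F; 3F; 4F; 5F)
open import Data.Fin.Properties using (_≟_; any?; all?; ¬∀⟶∃¬; pigeonhole; <⇒≢)
import Data.Fin.Permutation.Components as Components
open import Data.Fin.Permutation
  using (Permutation′; _⟨$⟩ʳ_; _⟨$⟩ˡ_; flip; transpose; id; inverseˡ; inverseʳ)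
open import Data.List using (List; []; _∷_; length; map)
open import Data.List.Properties using (length-map)
open import Data.Vec using (Vec; []; _∷_; lookup)
open import Data.Vec.Relation.Unary.All using (All; []; _∷_)
import Data.Vec.Relation.Unary.All as All
open import Data.Vec.Relation.Unary.All.Properties using (lookup⁻)
open import Data.Vec.Relation.Unary.AllPairs using ([]; _∷_)
open import Data.Vec.Relation.Unary.Unique.Propositional using (Unique)
open import Data.Vec.Relation.Unary.Unique.Propositional.Properties using (lookup-injective)
open import Data.Product using (Σ; ∃; _×_; _,_; proj₁; proj₂)
import Data.Product as Product
open import Data.Sum using (_⊎_)
import Data.Sum as Sum
open import Data.Empty using (⊥-elim)
open import Data.Unit using (tt)
open import Function.Definitions using (Injective)
open import Relation.Nullary using (¬_; Dec; yes; no)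
open import Relation.Nullary.Decidable
  using (True; toWitness; map′; ¬?; _×-dec_; _⊎-dec_; _→-dec_; decidable-stable)
open import Relation.Binary.PropositionalEquality
  using (_≡_; _≢_; ≢-sym; refl; sym; trans; cong; cong₂; subst; module ≡-Reasoning)

Inj : ∀ {k t} → (Fin k → Fin t) → Set
Inj = Injective _≡_ _≡_

Word : ℕ → Set
Word k = List (Fin k × Fin k)

relabel : ∀ {k t} → (Fin k → Fin t) → Word k → Word t
relabel f = map (Product.map f f)

module _ {t : ℕ} where
  swap : Fin t → Fin t → Fin t → Fin t
  swap = Components.transpose

  swap-left : (a b : Fin t) → swap a b a ≡ b
  swap-left a b with a ≟ a
  ... | yes _  = refl
  ... | no a≢a = ⊥-elim (a≢a refl)

  swap-right : (a b : Fin t) → swap a b b ≡ a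
  swap-right a b with b ≟ a
  ... | yes b≡a = b≡a
  ... | no _ with b ≟ b
  ...   | yes _  = refl
  ...   | no b≢b = ⊥-elim (b≢b refl)

  swap-other : (a b u : Fin t) → u ≢ a → u ≢ b → swap a b u ≡ u
  swap-other a b u u≢a u≢b with u ≟ a
  ... | yes u≡a = ⊥-elim (u≢a u≡a)
  ... | no _ with u ≟ b
  ...   | yes u≡b = ⊥-elim (u≢b u≡b)
  ...   | no _    = refl

swap-natural : ∀ {k t} (f : Fin k → Fin t) → Inj f →
  (a b u : Fin k) → f (swap a b u) ≡ swap (f a) (f b) (f u)
swap-natural f f-inj a b u = by-cases (u ≟ a) (u ≟ b)
  where
  by-cases : Dec (u ≡ a) → Dec (u ≡ b) → f (swap a b u) ≡ swap (f a) (f b) (f u)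
  by-cases (yes refl) _ = trans (cong f (swap-left u b)) (sym (swap-left (f u) (f b)))
  by-cases (no _) (yes refl) = trans (cong f (swap-right a u)) (sym (swap-right (f a) (f u)))
  by-cases (no u≢a) (no u≢b) =
    trans (cong f (swap-other a b u u≢a u≢b))
          (sym (swap-other (f a) (f b) (f u) (λ e → u≢a (f-inj e)) (λ e → u≢b (f-inj e))))

record Extends {k t : ℕ} (ι : Fin k → Fin t) (τ : Permutation′ k) (σ : Permutation′ t) : Set where
  field
    on-image  : ∀ j → σ ⟨$⟩ʳ ι j ≡ ι (τ ⟨$⟩ʳ j)
    off-image : ∀ z → (∀ j → z ≢ ι j) → σ ⟨$⟩ʳ z ≡ z
open Extends

module _ {k t : ℕ} {ι : Fin k → Fin t} where
  extends-id : Extends ι id id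
  extends-id = record { on-image = λ _ → refl ; off-image = λ _ _ → refl }

  extends-⊙ : ∀ {τ τ′ σ σ′} → Extends ι τ σ → Extends ι τ′ σ′ → Extends ι (τ ⊙ τ′) (σ ⊙ σ′)
  extends-⊙ {τ} {τ′} {σ} {σ′} E E′ = record
    { on-image  = λ j → trans (cong (σ ⟨$⟩ʳ_) (on-image E′ j)) (on-image E (τ′ ⟨$⟩ʳ j))
    ; off-image = λ z z∉ → trans (cong (σ ⟨$⟩ʳ_) (off-image E′ z z∉)) (off-image E z z∉)
    }

  extends-flip : ∀ {τ σ} → Extends ι τ σ → Extends ι (flip τ) (flip σ)
  extends-flip {τ} {σ} E = record
    { on-image  = λ j → begin
        σ ⟨$⟩ˡ ι j                             ≡⟨ cong (λ i → σ ⟨$⟩ˡ ι i) (inverseʳ τ) ⟨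
        σ ⟨$⟩ˡ ι (τ ⟨$⟩ʳ (τ ⟨$⟩ˡ j))            ≡⟨ cong (σ ⟨$⟩ˡ_) (on-image E (τ ⟨$⟩ˡ j)) ⟨
        σ ⟨$⟩ˡ (σ ⟨$⟩ʳ ι (τ ⟨$⟩ˡ j))            ≡⟨ inverseˡ σ ⟩
        ι (τ ⟨$⟩ˡ j)                           ∎
    ; off-image = λ z z∉ → trans (cong (σ ⟨$⟩ˡ_) (sym (off-image E z z∉))) (inverseˡ σ)
    }
    where open ≡-Reasoning

  extends-comm : ∀ {τ τ′ σ σ′} → Extends ι τ σ → Extends ι τ′ σ′ → Extends ι (comm τ τ′) (comm σ σ′)
  extends-comm E E′ = extends-⊙ E (extends-⊙ E′ (extends-⊙ (extends-flip E) (extends-flip E′)))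

  extends-≗ : ∀ {τ σ σ′} → Extends ι τ σ → (∀ z → σ ⟨$⟩ʳ z ≡ σ′ ⟨$⟩ʳ z) → Extends ι τ σ′
  extends-≗ E σ≗σ′ = record
    { on-image  = λ j → trans (sym (σ≗σ′ _)) (on-image E j)
    ; off-image = λ z z∉ → trans (sym (σ≗σ′ z)) (off-image E z z∉)
    }

  extends-prodTransp : Inj ι → (L : Word k) → Extends ι (prodTransp L) (prodTransp (relabel ι L))
  extends-prodTransp ι-inj [] = extends-id
  extends-prodTransp ι-inj ((a , b) ∷ L) = extends-⊙ extends-transpose (extends-prodTransp ι-inj L)
    where
    extends-transpose : Extends ι (transpose a b) (transpose (ι a) (ι b))
    extends-transpose = record
      { on-image  = λ j → sym (swap-natural ι ι-inj a b j)
      ; off-image = λ z z∉ → swap-other (ι a) (ι b) z (z∉ a) (z∉ b)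
      }

perm-injective : ∀ {t} (σ : Permutation′ t) → Inj (σ ⟨$⟩ʳ_)
perm-injective σ {a} {b} σa≡σb = trans (sym (inverseˡ σ)) (trans (cong (σ ⟨$⟩ˡ_) σa≡σb) (inverseˡ σ))

conjugate-prodTransp : ∀ {t} (α : Permutation′ t) (G : Word t) →
  ∀ z → (α ⊙ (prodTransp G ⊙ flip α)) ⟨$⟩ʳ z ≡ prodTransp (relabel (α ⟨$⟩ʳ_) G) ⟨$⟩ʳ z
conjugate-prodTransp α G z = begin
  α ⟨$⟩ʳ (prodTransp G ⟨$⟩ʳ (α ⟨$⟩ˡ z))        ≡⟨ on-image E (α ⟨$⟩ˡ z) ⟨
  αG ⟨$⟩ʳ (α ⟨$⟩ʳ (α ⟨$⟩ˡ z))                  ≡⟨ cong (αG ⟨$⟩ʳ_) (inverseʳ α) ⟩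
  αG ⟨$⟩ʳ z                                     ∎
  where
  open ≡-Reasoning
  αG = prodTransp (relabel (α ⟨$⟩ʳ_) G)
  E = extends-prodTransp (perm-injective α) G

-- If α moves the transpositions of ι(L) to those of ι(A), then the commutator
-- [α, ι(L)] = ι(A) · ι(L)⁻¹ extends the permutation A · L⁻¹ of Fin k.
comm-extends : ∀ {k t} (α : Permutation′ t) {ι : Fin k → Fin t} → Inj ι → (L A : Word k) →
  relabel (α ⟨$⟩ʳ_) (relabel ι L) ≡ relabel ι A →
  Extends ι (prodTransp A ⊙ flip (prodTransp L)) (comm α (prodTransp (relabel ι L)))
comm-extends α {ι} ι-inj L A αL≡A =
  extends-≗ (extends-⊙ (extends-prodTransp ι-inj A) (extends-flip (extends-prodTransp ι-inj L)))
    λ z → sym (trans (conjugate-prodTransp α (relabel ι L) (γ ⟨$⟩ˡ z))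
                      (cong (λ W → prodTransp W ⟨$⟩ʳ (γ ⟨$⟩ˡ z)) αL≡A))
  where γ = prodTransp (relabel ι L)

module _ {k t : ℕ} {ι : Fin k → Fin t} (ι-inj : Inj ι) {τ σ} (E : Extends ι τ σ) where
  private
    ι-≢ : ∀ {a b} → a ≢ b → ι a ≢ ι b
    ι-≢ a≢b e = a≢b (ι-inj e)

    maps : ∀ {a b} → τ ⟨$⟩ʳ a ≡ b → σ ⟨$⟩ʳ ι a ≡ ι b
    maps τa≡b = trans (on-image E _) (cong ι τa≡b)

    fixes : ∀ z → (∀ j → z ≡ ι j → τ ⟨$⟩ʳ j ≡ j) → σ ⟨$⟩ʳ z ≡ z
    fixes z fixed-on-preimage with any? (λ j → z ≟ ι j)
    ... | yes (j , refl) = maps (fixed-on-preimage j refl)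
    ... | no z∉ = off-image E z (λ j z≡ιj → z∉ (j , z≡ιj))

    avoids : ∀ {z a} → z ≢ ι a → ∀ {j} → z ≡ ι j → j ≢ a
    avoids z≢ιa z≡ιj refl = z≢ιa z≡ιj

  double-transposition-transfer : IsDoubleTransposition τ → IsDoubleTransposition σ
  double-transposition-transfer (a , b , c , d , ab , ac , ad , bc , bd , cd , τa , τb , τc , τd , rest) =
    ι a , ι b , ι c , ι d , ι-≢ ab , ι-≢ ac , ι-≢ ad , ι-≢ bc , ι-≢ bd , ι-≢ cd ,
    maps τa , maps τb , maps τc , maps τd ,
    λ z za zb zc zd → fixes z λ j e → rest j (avoids za e) (avoids zb e) (avoids zc e) (avoids zd e)

  three-cycle-transfer : IsThreeCycle τ → IsThreeCycle σ
  three-cycle-transfer (a , b , c , ab , ac , bc , τa , τb , τc , rest) =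
    ι a , ι b , ι c , ι-≢ ab , ι-≢ ac , ι-≢ bc , maps τa , maps τb , maps τc ,
    λ z za zb zc → fixes z λ j e → rest j (avoids za e) (avoids zb e) (avoids zc e)

EvenWord : ∀ {k} → Word k → Set
EvenWord L = AllTransp L × Even (length L)

even-relabel : ∀ {k t} {ι : Fin k → Fin t} → Inj ι → (L : Word k) → EvenWord L →
  IsEvenPerm (prodTransp (relabel ι L))
even-relabel {ι = ι} ι-inj L (transps , even) =
  relabel ι L , all-transp transps , subst Even (sym (length-map _ L)) even , λ _ → refl
  where
  all-transp : ∀ {M} → AllTransp M → AllTransp (relabel ι M)
  all-transp [] = []
  all-transp (a≢b ∷ rest) = (λ e → a≢b (ι-inj e)) ∷ all-transp rest

module _ {k : ℕ} where
  private
    _≢?_ : (a b : Fin k) → Dec (a ≢ b)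
    a ≢? b = ¬? (a ≟ b)

  double-transposition? : (τ : Permutation′ k) → Dec (IsDoubleTransposition τ)
  double-transposition? τ = any? λ a → any? λ b → any? λ c → any? λ d →
    a ≢? b ×-dec a ≢? c ×-dec a ≢? d ×-dec b ≢? c ×-dec b ≢? d ×-dec c ≢? d ×-dec
    τ ⟨$⟩ʳ a ≟ b ×-dec τ ⟨$⟩ʳ b ≟ a ×-dec τ ⟨$⟩ʳ c ≟ d ×-dec τ ⟨$⟩ʳ d ≟ c ×-dec
    all? λ x → x ≢? a →-dec x ≢? b →-dec x ≢? c →-dec x ≢? d →-dec τ ⟨$⟩ʳ x ≟ x

  three-cycle? : (τ : Permutation′ k) → Dec (IsThreeCycle τ)
  three-cycle? τ = any? λ a → any? λ b → any? λ c →
    a ≢? b ×-dec a ≢? c ×-dec b ≢? c ×-dec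
    τ ⟨$⟩ʳ a ≟ b ×-dec τ ⟨$⟩ʳ b ≟ c ×-dec τ ⟨$⟩ʳ c ≟ a ×-dec
    all? λ x → x ≢? a →-dec x ≢? b →-dec x ≢? c →-dec τ ⟨$⟩ʳ x ≟ x

  small-shape? : (τ : Permutation′ k) → Dec (IsDoubleTransposition τ ⊎ IsThreeCycle τ)
  small-shape? τ = double-transposition? τ ⊎-dec three-cycle? τ

even? : ∀ n → Dec (Even n)
even? 0 = yes even-zero
even? 1 = no λ ()
even? (suc (suc n)) = map′ even-ss (λ { (even-ss e) → e }) (even? n)

all-transp? : ∀ {k} (L : Word k) → Dec (AllTransp L)
all-transp? [] = yes []
all-transp? ((a , b) ∷ L) =
  map′ (λ (a≢b , rest) → a≢b ∷ rest) (λ { (a≢b ∷ rest) → a≢b , rest }) (¬? (a ≟ b) ×-dec all-transp? L)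

even-word? : ∀ {k} (L : Word k) → Dec (EvenWord L)
even-word? L = all-transp? L ×-dec even? (length L)

CommutatorWitness : ∀ {t} → Permutation′ t → Set
CommutatorWitness {t} α = Σ (Permutation′ t) λ γ₁ → Σ (Permutation′ t) λ γ₂ →
  IsEvenPerm γ₁ × IsEvenPerm γ₂ ×
  (IsDoubleTransposition γ₁ ⊎ IsThreeCycle γ₁) ×
  (IsDoubleTransposition γ₂ ⊎ IsThreeCycle γ₂) ×
  IsDoubleTransposition (comm (comm α γ₁) γ₂)

-- What is checked on k points: γ₁ = L₁ and γ₂ = L₂ are even words of an allowed
-- shape, and if α conjugates L₁ to A₁ then [[α,γ₁],γ₂] = [A₁ L₁⁻¹, L₂].
Valid : ∀ {k} → Word k → Word k → Word k → Set
Valid L₁ A₁ L₂ =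
  EvenWord L₁ × EvenWord L₂ ×
  (IsDoubleTransposition (prodTransp L₁) ⊎ IsThreeCycle (prodTransp L₁)) ×
  (IsDoubleTransposition (prodTransp L₂) ⊎ IsThreeCycle (prodTransp L₂)) ×
  IsDoubleTransposition (comm (prodTransp A₁ ⊙ flip (prodTransp L₁)) (prodTransp L₂))

valid? : ∀ {k} (L₁ A₁ L₂ : Word k) → Dec (Valid L₁ A₁ L₂)
valid? L₁ A₁ L₂ =
  even-word? L₁ ×-dec even-word? L₂ ×-dec small-shape? (prodTransp L₁) ×-dec small-shape? (prodTransp L₂) ×-dec
  double-transposition? (comm (prodTransp A₁ ⊙ flip (prodTransp L₁)) (prodTransp L₂))

record Certificate (k : ℕ) : Set where
  field
    L₁ A₁ L₂ : Word k
    valid    : True (valid? L₁ A₁ L₂)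

witness-from-certificate : ∀ {k t} (C : Certificate k) (α : Permutation′ t) (v : Vec (Fin t) k) →
  Unique v → relabel (α ⟨$⟩ʳ_) (relabel (lookup v) (Certificate.L₁ C)) ≡ relabel (lookup v) (Certificate.A₁ C) →
  CommutatorWitness α
witness-from-certificate C α v v-unique α-moves
  with toWitness (Certificate.valid C)
... | even₁ , even₂ , shape₁ , shape₂ , double-transposition =
  prodTransp (relabel ι L₁) , prodTransp (relabel ι L₂) ,
  even-relabel ι-inj L₁ even₁ , even-relabel ι-inj L₂ even₂ ,
  shape-transfer L₁ shape₁ , shape-transfer L₂ shape₂ ,
  double-transposition-transfer ι-inj
    (extends-comm (comm-extends α ι-inj L₁ A₁ α-moves) (extends-prodTransp ι-inj L₂))
    double-transposition
  where
  open Certificate C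
  ι = lookup v
  ι-inj : Inj ι
  ι-inj {i} {j} = lookup-injective v-unique i j
  shape-transfer : ∀ L → IsDoubleTransposition (prodTransp L) ⊎ IsThreeCycle (prodTransp L) →
    IsDoubleTransposition (prodTransp (relabel ι L)) ⊎ IsThreeCycle (prodTransp (relabel ι L))
  shape-transfer L = Sum.map (double-transposition-transfer ι-inj (extends-prodTransp ι-inj L))
                             (three-cycle-transfer ι-inj (extends-prodTransp ι-inj L))

-- The five local configurations.  Points are indexed 0,1,… in the order listed.

-- α maps 0 ↦ 1 ↦ 2 ↦ 3 (an orbit of length at least 4).
long-orbit : Certificate 4
long-orbit = record { L₁ = (0F , 2F) ∷ (0F , 1F) ∷ [] ; A₁ = (1F , 3F) ∷ (1F , 2F) ∷ []
                    ; L₂ = (0F , 2F) ∷ (0F , 1F) ∷ [] ; valid = tt }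

-- α swaps 0 and 1 and fixes 2 (3 is any other point).
swap-and-fixed : Certificate 4
swap-and-fixed = record { L₁ = (0F , 2F) ∷ (0F , 1F) ∷ [] ; A₁ = (1F , 2F) ∷ (1F , 0F) ∷ []
                        ; L₂ = (0F , 3F) ∷ (0F , 1F) ∷ [] ; valid = tt }

-- α swaps 0 and 1 and moves 2 to 3.
swap-and-moved : Certificate 4
swap-and-moved = record { L₁ = (0F , 2F) ∷ (0F , 1F) ∷ [] ; A₁ = (1F , 3F) ∷ (1F , 0F) ∷ []
                        ; L₂ = (0F , 2F) ∷ (0F , 1F) ∷ [] ; valid = tt }

-- α maps 0 ↦ 1 ↦ 2 and fixes 3.
path-and-fixed : Certificate 4
path-and-fixed = record { L₁ = (0F , 3F) ∷ (0F , 1F) ∷ [] ; A₁ = (1F , 3F) ∷ (1F , 2F) ∷ []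
                        ; L₂ = (0F , 2F) ∷ (0F , 1F) ∷ [] ; valid = tt }

-- α maps 0 ↦ 1 ↦ 2 and 3 ↦ 4 ↦ 5.
two-paths : Certificate 6
two-paths = record { L₁ = (0F , 3F) ∷ (1F , 4F) ∷ [] ; A₁ = (1F , 4F) ∷ (2F , 5F) ∷ []
                   ; L₂ = (0F , 3F) ∷ (0F , 2F) ∷ [] ; valid = tt }

_∉_ : ∀ {t n} → Fin t → Vec (Fin t) n → Set
c ∉ xs = All (_≢ c) xs

not-exhaustive : ∀ {n t} → n < t → (xs : Vec (Fin t) n) → ¬ (∀ c → ∃ λ i → lookup xs i ≡ c)
not-exhaustive n<t xs position with pigeonhole n<t (λ c → proj₁ (position c))
... | i , j , i<j , same-position =
  <⇒≢ i<j (trans (sym (proj₂ (position i))) (trans (cong (lookup xs) same-position) (proj₂ (position j))))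

fresh : ∀ {n t} → n < t → (xs : Vec (Fin t) n) → ∃ λ c → c ∉ xs
fresh {n} n<t xs with any? (λ c → All.all? (λ x → ¬? (x ≟ c)) xs)
... | yes found = found
... | no none = ⊥-elim (not-exhaustive n<t xs position)
  where
  position : ∀ c → ∃ λ i → lookup xs i ≡ c
  position c with ¬∀⟶∃¬ n (λ i → lookup xs i ≢ c) (λ i → ¬? (lookup xs i ≟ c)) (λ avoids → none (c , lookup⁻ avoids))
  ... | i , not-avoided = i , decidable-stable (lookup xs i ≟ c) not-avoided

module Orbits {t : ℕ} (α : Permutation′ t) where
  next : Fin t → Fin t
  next = α ⟨$⟩ʳ_

  next-≢ : ∀ {a b} → a ≢ b → next a ≢ next b
  next-≢ a≢b e = a≢b (perm-injective α e)

  data Orbit (x : Fin t) : Set where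
    fixed   : next x ≡ x → Orbit x
    2-cycle : x ≢ next x → next (next x) ≡ x → Orbit x
    3-cycle : x ≢ next x → x ≢ next (next x) → next (next (next x)) ≡ x → Orbit x
    long    : x ≢ next x → x ≢ next (next x) → x ≢ next (next (next x)) → Orbit x

  orbit : ∀ x → Orbit x
  orbit x with next x ≟ x
  ... | yes x-fixed = fixed x-fixed
  ... | no x-moved with next (next x) ≟ x
  ...   | yes back₂ = 2-cycle (≢-sym x-moved) back₂
  ...   | no not-back₂ with next (next (next x)) ≟ x
  ...     | yes back₃ = 3-cycle (≢-sym x-moved) (≢-sym not-back₂) back₃
  ...     | no not-back₃ = long (≢-sym x-moved) (≢-sym not-back₂) (≢-sym not-back₃)

  path : Fin t → Vec (Fin t) 3
  path x = x ∷ next x ∷ next (next x) ∷ []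

  outside-3-cycle : ∀ {x c} → next (next (next x)) ≡ x → c ∉ path x → next c ∉ path x
  outside-3-cycle back (x≢c ∷ x₁≢c ∷ x₂≢c ∷ []) =
    (λ e → x₂≢c (perm-injective α (trans back e))) ∷ next-≢ x≢c ∷ next-≢ x₁≢c ∷ []

  long-orbit-case : ∀ {x} → x ≢ next x → x ≢ next (next x) → x ≢ next (next (next x)) →
    CommutatorWitness α
  long-orbit-case {x} x≢x₁ x≢x₂ x≢x₃ =
    witness-from-certificate long-orbit α (x ∷ next x ∷ next (next x) ∷ next (next (next x)) ∷ [])
      ((x≢x₁ ∷ x≢x₂ ∷ x≢x₃ ∷ []) ∷ (next-≢ x≢x₁ ∷ next-≢ x≢x₂ ∷ []) ∷ (next-≢ (next-≢ x≢x₁) ∷ []) ∷ [] ∷ [])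
      refl

  swap-and-fixed-case : ∀ {x c r} → x ≢ next x → next (next x) ≡ x →
    c ∉ (x ∷ next x ∷ []) → next c ≡ c → r ∉ (x ∷ next x ∷ c ∷ []) → CommutatorWitness α
  swap-and-fixed-case {x} {c} {r} x≢x₁ back (x≢c ∷ x₁≢c ∷ []) c-fixed (x≢r ∷ x₁≢r ∷ c≢r ∷ []) =
    witness-from-certificate swap-and-fixed α (x ∷ next x ∷ c ∷ r ∷ [])
      ((x≢x₁ ∷ x≢c ∷ x≢r ∷ []) ∷ (x₁≢c ∷ x₁≢r ∷ []) ∷ (c≢r ∷ []) ∷ [] ∷ [])
      (cong₂ (λ p q → (next x , p) ∷ (next x , q) ∷ []) c-fixed back)

  swap-and-moved-case : ∀ {x d} → x ≢ next x → next (next x) ≡ x →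
    d ∉ (x ∷ next x ∷ []) → d ≢ next d → CommutatorWitness α
  swap-and-moved-case {x} {d} x≢x₁ back (x≢d ∷ x₁≢d ∷ []) d≢d₁ =
    witness-from-certificate swap-and-moved α (x ∷ next x ∷ d ∷ next d ∷ [])
      ((x≢x₁ ∷ x≢d ∷ x≢d₁ ∷ []) ∷ (x₁≢d ∷ next-≢ x≢d ∷ []) ∷ (d≢d₁ ∷ []) ∷ [] ∷ [])
      (cong (λ q → (next x , next d) ∷ (next x , q) ∷ []) back)
    where
    x≢d₁ : x ≢ next d
    x≢d₁ e = x₁≢d (perm-injective α (trans back e))

  path-and-fixed-case : ∀ {x c} → x ≢ next x → x ≢ next (next x) →
    c ∉ path x → next c ≡ c → CommutatorWitness α
  path-and-fixed-case {x} {c} x≢x₁ x≢x₂ (x≢c ∷ x₁≢c ∷ x₂≢c ∷ []) c-fixed =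
    witness-from-certificate path-and-fixed α (x ∷ next x ∷ next (next x) ∷ c ∷ [])
      ((x≢x₁ ∷ x≢x₂ ∷ x≢c ∷ []) ∷ (next-≢ x≢x₁ ∷ x₁≢c ∷ []) ∷ (x₂≢c ∷ []) ∷ [] ∷ [])
      (cong (λ p → (next x , p) ∷ (next x , next (next x)) ∷ []) c-fixed)

  two-paths-case : ∀ {x c} → x ≢ next x → x ≢ next (next x) → c ≢ next c → c ≢ next (next c) →
    c ∉ path x → next c ∉ path x → next (next c) ∉ path x → CommutatorWitness α
  two-paths-case {x} {c} x≢x₁ x≢x₂ c≢c₁ c≢c₂
    (x≢c ∷ x₁≢c ∷ x₂≢c ∷ []) (x≢c₁ ∷ x₁≢c₁ ∷ x₂≢c₁ ∷ []) (x≢c₂ ∷ x₁≢c₂ ∷ x₂≢c₂ ∷ []) =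
    witness-from-certificate two-paths α (x ∷ next x ∷ next (next x) ∷ c ∷ next c ∷ next (next c) ∷ [])
      ((x≢x₁ ∷ x≢x₂ ∷ x≢c ∷ x≢c₁ ∷ x≢c₂ ∷ []) ∷ (next-≢ x≢x₁ ∷ x₁≢c ∷ x₁≢c₁ ∷ x₁≢c₂ ∷ []) ∷
       (x₂≢c ∷ x₂≢c₁ ∷ x₂≢c₂ ∷ []) ∷ (c≢c₁ ∷ c≢c₂ ∷ []) ∷ (next-≢ c≢c₁ ∷ []) ∷ [] ∷ [])
      refl

  witness : 3 < t → ∀ x → next x ≢ x → CommutatorWitness α
  witness 3<t x x-moved with orbit x
  ... | fixed x-fixed = ⊥-elim (x-moved x-fixed)
  ... | long x≢x₁ x≢x₂ x≢x₃ = long-orbit-case x≢x₁ x≢x₂ x≢x₃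
  ... | 2-cycle x≢x₁ back with fresh (≤-trans (n≤1+n 3) 3<t) (x ∷ next x ∷ [])
  ...   | c , c∉ with next c ≟ c
  ...     | yes c-fixed = swap-and-fixed-case x≢x₁ back c∉ c-fixed (proj₂ (fresh 3<t (x ∷ next x ∷ c ∷ [])))
  ...     | no c-moved = swap-and-moved-case x≢x₁ back c∉ (≢-sym c-moved)
  witness 3<t x x-moved | 3-cycle x≢x₁ x≢x₂ back with fresh 3<t (path x)
  ... | c , c∉ with orbit c
  ...   | fixed c-fixed = path-and-fixed-case x≢x₁ x≢x₂ c∉ c-fixed
  ...   | 2-cycle c≢c₁ c-back = swap-and-moved-case c≢c₁ c-back (x∉ c∉ (outside-3-cycle back c∉)) x≢x₁
    where
    x∉ : c ∉ path x → next c ∉ path x → x ∉ (c ∷ next c ∷ [])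
    x∉ (x≢c ∷ _) (x≢c₁ ∷ _) = ≢-sym x≢c ∷ ≢-sym x≢c₁ ∷ []
  ...   | 3-cycle c≢c₁ c≢c₂ _ =
    two-paths-case x≢x₁ x≢x₂ c≢c₁ c≢c₂ c∉ c₁∉ (outside-3-cycle back c₁∉)
    where c₁∉ = outside-3-cycle back c∉
  ...   | long c≢c₁ c≢c₂ c≢c₃ = long-orbit-case c≢c₁ c≢c₂ c≢c₃

lemma2p3 : (t : ℕ) → 4 ≤ t → (α : Permutation′ t) → IsEvenPerm α → ¬ IsId α →
    Σ (Permutation′ t) λ γ₁ → Σ (Permutation′ t) λ γ₂ →
      IsEvenPerm γ₁ × IsEvenPerm γ₂ ×
      (IsDoubleTransposition γ₁ ⊎ IsThreeCycle γ₁) ×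
      (IsDoubleTransposition γ₂ ⊎ IsThreeCycle γ₂) ×
      IsDoubleTransposition (comm (comm α γ₁) γ₂)
lemma2p3 t 4≤t α _ not-identity
  with ¬∀⟶∃¬ t (λ x → α ⟨$⟩ʳ x ≡ x) (λ x → α ⟨$⟩ʳ x ≟ x) not-identity
... | x , x-moved = Orbits.witness α 4≤t x x-moved
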